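{- Let $p$ be a prime and $d>2$ an integer. Then there exist constants $C>0$ and $\gamma$ with $1\le\gamma<p$, depending only on $p$ and $d$, such that for every $n\ge1$, every $d$-colored sum-ordered set in $\mathbb F_p^n$ has size $N\le C\gamma^n$ (i.e. $N=O(\gamma^n)$).
   Context: For a poset $P=([d],<_P)$ on $[d]$ and $t\ge0$, the order polytope is $\mathcal O_t(P)=\{(z_1,\dots,z_d)\in\mathbb R^d: 0\le z_i\le t \text{ for all } i,\ z_i\le z_j \text{ whenever } i<_P j\}$. A $d$-colored sum-ordered set in $\mathbb F_p^n$ of size $N$ is an ordered collection $(x^{(\ell)}_i)_{\ell\in[d],\,i\in[N]}$ of vectors $x^{(\ell)}_i\in\mathbb F_p^n$ such that $\sum_{\ell=1}^d x^{(\ell)}_i=0$ for every $i\in[N]$, and such that there is a poset $P$ on $[d]$ whose Hasse diagram is connected (as an undirected graph) with the property: for all $i_1,\dots,i_d\in[N]$, $\sum_{\ell=1}^d x^{(\ell)}_{i_\ell}=0$ implies $(i_1,\dots,i_d)\in\mathcal O_N(P)$. -}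

module Defs where

open import Level using (0ℓ)
open import Data.Nat using (ℕ; zero; suc; _+_; _≤_)
open import Data.Nat.Divisibility using (_∣_)
open import Data.Fin using (Fin; zero; suc; toℕ)
open import Data.Product using (_×_; Σ)
open import Data.Sum using (_⊎_)
open import Relation.Nullary using (¬_)
open import Relation.Binary.PropositionalEquality using (_≡_)
open import Relation.Binary.Core using (Rel)
open import Relation.Binary.Structures using (IsStrictPartialOrder)
open import Relation.Binary.Construct.Closure.ReflexiveTransitive using (Star)

sumFin : (d : ℕ) → (Fin d → ℕ) → ℕ
sumFin zero    f = 0
sumFin (suc d) f = f zero + sumFin d (λ i → f (suc i))

-- Vectors of F_p^n, with F_p represented by Fin p (residues 0..p-1).
Fpn : ℕ → ℕ → Set
Fpn p n = Fin n → Fin p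

-- The sum of the vectors v ℓ (ℓ ∈ [d]) is zero in F_p^n:
-- every coordinate sum is ≡ 0 (mod p).
SumZero : (p n d : ℕ) → (Fin d → Fpn p n) → Set
SumZero p n d v = ∀ (k : Fin n) → p ∣ sumFin d (λ ℓ → toℕ (v ℓ k))

Cover : {d : ℕ} → Rel (Fin d) 0ℓ → Fin d → Fin d → Set
Cover _<_ i j = (i < j) × (∀ k → ¬ ((i < k) × (k < j)))

HasseConnected : {d : ℕ} → Rel (Fin d) 0ℓ → Set
HasseConnected {d} _<_ =
  ∀ (i j : Fin d) → Star (λ a b → Cover _<_ a b ⊎ Cover _<_ b a) i j

-- (i_1,…,i_d) ∈ O_N(P) for indices in [N] (0 ≤ i_ℓ ≤ N is automatic).
InOrderPolytope : {d N : ℕ} → Rel (Fin d) 0ℓ → (Fin d → Fin N) → Set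
InOrderPolytope {d} _<_ ι = ∀ (a b : Fin d) → a < b → toℕ (ι a) ≤ toℕ (ι b)

-- d-colored sum-ordered set in F_p^n of size N: x ℓ i = x^{(ℓ)}_i.
SumOrdered : (p n d N : ℕ) → (Fin d → Fin N → Fpn p n) → Set₁
SumOrdered p n d N x =
  (∀ (i : Fin N) → SumZero p n d (λ ℓ → x ℓ i)) ×
  Σ (Rel (Fin d) 0ℓ) (λ _<_ →
    IsStrictPartialOrder _≡_ _<_ ×
    HasseConnected _<_ ×
    (∀ (ι : Fin d → Fin N) → SumZero p n d (λ ℓ → x ℓ (ι ℓ)) → InOrderPolytope _<_ ι))

-- Over 𝔽_p, p = q + 1, the polynomial P(z) = ∏_k ∏_{a<q} ((a+1) + q Σ_ℓ z_ℓk) is, up to a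
-- unit, the indicator that the d vectors z_ℓ sum to zero. Each monomial of P has degree
-- ≤ qn, so one of its d ≥ 3 colours has degree ≤ qn/3. For each colour, Gaussian
-- elimination against the m functions i ↦ (x^{(ℓ)}_i)^e with deg e ≤ qn/3 leaves at most
-- m pivots; if N > dm, some index a is a pivot for no colour, and the resulting
-- annihilators c_ℓ make Σ_ι ∏_ℓ c_ℓ(ι_ℓ) P(x_ι) vanish mod p. Ranking the indices of each
-- colour upwards or downwards according to a Hasse neighbour, the order-polytope property
-- leaves only the diagonal term ι = (a,…,a), which is nonzero mod p. Hence N ≤ dm, and
-- Rankin's trick gives m ≤ (Q/b)ⁿ with b ≤ Q < p b.
module Submission where

open import Data.Bool.Base using (if_then_else_)
open import Data.Empty using (⊥; ⊥-elim)
open import Data.Fin.Base using (Fin; zero; suc; toℕ; fromℕ<)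
open import Data.Fin.Properties using (_≟_)
import Data.Fin.Properties as Fin
open import Data.List.Base using (List; []; _∷_; _++_; map; length; concatMap; allFin; tabulate; lookup)
open import Data.List.Properties using (length-++; length-map)
open import Data.List.Membership.Propositional using (_∈_; lose)
open import Data.List.Membership.Propositional.Properties using (∈-map⁺; ∈-concatMap⁺; ∈-allFin)
open import Data.List.Relation.Unary.Any using (here; there; index)
open import Data.List.Relation.Unary.Any.Properties using (lookup-index)
open import Data.Nat hiding (_≟_)
open import Data.Nat.Properties hiding (_≟_)
open import Data.Nat.Divisibility
open import Data.Nat.DivMod using (_%_; _/_; m≡m%n+[m/n]*n; m%n<n; m*n/n≡m; /-monoˡ-≤; m/n*n≤m)
open import Data.Nat.Primality using (Prime; euclidsLemma; ¬prime[0]; ¬prime[1])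
open import Data.Nat.Tactic.RingSolver using (solve-∀)
open import Data.Product using (_×_; _,_; ∃; proj₁; proj₂)
open import Data.Sum using (_⊎_; inj₁; inj₂)
import Data.Vec.Functional as Vector
open import Relation.Binary.PropositionalEquality
open import Relation.Nullary using (¬_; Dec; yes; no; ¬?; does; _×-dec_)
open import Relation.Nullary.Decidable using (dec-true; dec-false; decidable-stable)
open import Function.Definitions using (Injective)
open import Level using (0ℓ)
open import Relation.Binary.Core using (Rel)
open import Relation.Binary.Definitions using (Transitive; Irreflexive)
open import Relation.Binary.Structures using (IsStrictPartialOrder)
open import Relation.Binary.Construct.Closure.ReflexiveTransitive using (Star; ε; _◅_)

open import Algebra.Properties.CommutativeSemigroup +-commutativeSemigroup using ()
  renaming (interchange to +-interchange)
open import Algebra.Properties.CommutativeSemigroup *-commutativeSemigroup using ()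
  renaming (interchange to *-interchange)

open import Defs

∑ : {A : Set} → List A → (A → ℕ) → ℕ
∑ []       f = 0
∑ (x ∷ xs) f = f x + ∑ xs f

∏ : (m : ℕ) → (Fin m → ℕ) → ℕ
∏ zero    f = 1
∏ (suc m) f = f zero * ∏ m (λ i → f (suc i))

choices : {A : Set} (m : ℕ) → List A → List (Fin m → A)
choices zero    ys = (λ ()) ∷ []
choices (suc m) ys = concatMap (λ y → map (y Vector.∷_) (choices m ys)) ys

module _ {A : Set} where

  ∑-cong : (xs : List A) {f g : A → ℕ} → (∀ x → f x ≡ g x) → ∑ xs f ≡ ∑ xs g
  ∑-cong []       e = refl
  ∑-cong (x ∷ xs) e = cong₂ _+_ (e x) (∑-cong xs e)

  ∑-++ : (xs ys : List A) (f : A → ℕ) → ∑ (xs ++ ys) f ≡ ∑ xs f + ∑ ys f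
  ∑-++ []       ys f = refl
  ∑-++ (x ∷ xs) ys f = trans (cong (f x +_) (∑-++ xs ys f)) (sym (+-assoc (f x) _ _))

  *-distribˡ-∑ : (c : ℕ) (xs : List A) (f : A → ℕ) → c * ∑ xs f ≡ ∑ xs (λ x → c * f x)
  *-distribˡ-∑ c []       f = *-zeroʳ c
  *-distribˡ-∑ c (x ∷ xs) f = trans (*-distribˡ-+ c (f x) _) (cong (c * f x +_) (*-distribˡ-∑ c xs f))

  ∑-+ : (xs : List A) (f g : A → ℕ) → ∑ xs (λ x → f x + g x) ≡ ∑ xs f + ∑ xs g
  ∑-+ []       f g = refl
  ∑-+ (x ∷ xs) f g = trans (cong (f x + g x +_) (∑-+ xs f g)) (+-interchange (f x) (g x) _ _)

  ∑-zero : (xs : List A) → ∑ xs (λ _ → 0) ≡ 0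
  ∑-zero []       = refl
  ∑-zero (x ∷ xs) = ∑-zero xs

  ∑-mono-≤ : (xs : List A) {f g : A → ℕ} → (∀ x → f x ≤ g x) → ∑ xs f ≤ ∑ xs g
  ∑-mono-≤ []       h = z≤n
  ∑-mono-≤ (x ∷ xs) h = +-mono-≤ (h x) (∑-mono-≤ xs h)

  ∣-∑ : {p : ℕ} (xs : List A) (f : A → ℕ) → (∀ x → p ∣ f x) → p ∣ ∑ xs f
  ∣-∑ {p} []       f h = p ∣0
  ∣-∑     (x ∷ xs) f h = ∣m∣n⇒∣m+n (h x) (∣-∑ xs f h)

module _ {A B : Set} where

  ∑-map : (h : A → B) (xs : List A) (f : B → ℕ) → ∑ (map h xs) f ≡ ∑ xs (λ x → f (h x))
  ∑-map h []       f = refl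
  ∑-map h (x ∷ xs) f = cong (f (h x) +_) (∑-map h xs f)

  ∑-concatMap : (h : A → List B) (xs : List A) (f : B → ℕ) →
                ∑ (concatMap h xs) f ≡ ∑ xs (λ x → ∑ (h x) f)
  ∑-concatMap h []       f = refl
  ∑-concatMap h (x ∷ xs) f = trans (∑-++ (h x) _ f) (cong (∑ (h x) f +_) (∑-concatMap h xs f))

  ∑-swap : (xs : List A) (ys : List B) (f : A → B → ℕ) →
           ∑ xs (λ x → ∑ ys (f x)) ≡ ∑ ys (λ y → ∑ xs (λ x → f x y))
  ∑-swap []       ys f = sym (∑-zero ys)
  ∑-swap (x ∷ xs) ys f = trans (cong (∑ ys (f x) +_) (∑-swap xs ys f))
                               (sym (∑-+ ys (f x) (λ y → ∑ xs (λ x′ → f x′ y))))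

  length-concatMap : (h : A → List B) (xs : List A) → length (concatMap h xs) ≡ ∑ xs (λ x → length (h x))
  length-concatMap h []       = refl
  length-concatMap h (x ∷ xs) = trans (length-++ (h x)) (cong (length (h x) +_) (length-concatMap h xs))

∑-tabulate : {A : Set} (m : ℕ) (g : Fin m → A) (f : A → ℕ) → ∑ (tabulate g) f ≡ sumFin m (λ i → f (g i))
∑-tabulate zero    g f = refl
∑-tabulate (suc m) g f = cong (f (g zero) +_) (∑-tabulate m (λ i → g (suc i)) f)

∑-allFin : (m : ℕ) (f : Fin m → ℕ) → ∑ (allFin m) f ≡ sumFin m f
∑-allFin m f = ∑-tabulate m (λ i → i) f

sumFin-cong : (m : ℕ) {f g : Fin m → ℕ} → (∀ i → f i ≡ g i) → sumFin m f ≡ sumFin m g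
sumFin-cong m {f} {g} e = trans (sym (∑-allFin m f)) (trans (∑-cong (allFin m) e) (∑-allFin m g))

*-distribˡ-sumFin : (c m : ℕ) (f : Fin m → ℕ) → c * sumFin m f ≡ sumFin m (λ i → c * f i)
*-distribˡ-sumFin c m f = trans (cong (c *_) (sym (∑-allFin m f)))
                                (trans (*-distribˡ-∑ c (allFin m) f) (∑-allFin m _))

sumFin-mono-≤ : (m : ℕ) {f g : Fin m → ℕ} → (∀ i → f i ≤ g i) → sumFin m f ≤ sumFin m g
sumFin-mono-≤ m {f} {g} h = subst₂ _≤_ (∑-allFin m f) (∑-allFin m g) (∑-mono-≤ (allFin m) h)

sumFin-const : (m c : ℕ) → sumFin m (λ _ → c) ≡ m * c
sumFin-const zero    c = refl
sumFin-const (suc m) c = cong (c +_) (sumFin-const m c)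

sumFin-swap : (m k : ℕ) (f : Fin m → Fin k → ℕ) →
              sumFin m (λ i → sumFin k (f i)) ≡ sumFin k (λ j → sumFin m (λ i → f i j))
sumFin-swap m k f = begin
  sumFin m (λ i → sumFin k (f i))                    ≡⟨ sym (∑-allFin m _) ⟩
  ∑ (allFin m) (λ i → sumFin k (f i))                ≡⟨ ∑-cong (allFin m) (λ i → sym (∑-allFin k (f i))) ⟩
  ∑ (allFin m) (λ i → ∑ (allFin k) (f i))            ≡⟨ ∑-swap (allFin m) (allFin k) f ⟩
  ∑ (allFin k) (λ j → ∑ (allFin m) (λ i → f i j))    ≡⟨ ∑-cong (allFin k) (λ j → ∑-allFin m (λ i → f i j)) ⟩
  ∑ (allFin k) (λ j → sumFin m (λ i → f i j))        ≡⟨ ∑-allFin k _ ⟩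
  sumFin k (λ j → sumFin m (λ i → f i j))            ∎
  where open ≡-Reasoning

∏-cong : (m : ℕ) {f g : Fin m → ℕ} → (∀ i → f i ≡ g i) → ∏ m f ≡ ∏ m g
∏-cong zero    e = refl
∏-cong (suc m) e = cong₂ _*_ (e zero) (∏-cong m (λ i → e (suc i)))

∏-one : (m : ℕ) → ∏ m (λ _ → 1) ≡ 1
∏-one zero    = refl
∏-one (suc m) = trans (+-identityʳ _) (∏-one m)

∏-* : (m : ℕ) (f g : Fin m → ℕ) → ∏ m (λ i → f i * g i) ≡ ∏ m f * ∏ m g
∏-* zero    f g = refl
∏-* (suc m) f g = trans (cong (f zero * g zero *_) (∏-* m (λ i → f (suc i)) (λ i → g (suc i))))
                        (*-interchange (f zero) (g zero) _ _)

∏-swap : (m k : ℕ) (f : Fin m → Fin k → ℕ) →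
         ∏ m (λ i → ∏ k (f i)) ≡ ∏ k (λ j → ∏ m (λ i → f i j))
∏-swap zero    k f = sym (∏-one k)
∏-swap (suc m) k f = trans (cong (∏ k (f zero) *_) (∏-swap m k (λ i → f (suc i))))
                           (sym (∏-* k (f zero) (λ j → ∏ m (λ i → f (suc i) j))))

∏-^ : (w m : ℕ) (e : Fin m → ℕ) → ∏ m (λ i → w ^ e i) ≡ w ^ sumFin m e
∏-^ w zero    e = refl
∏-^ w (suc m) e = trans (cong (w ^ e zero *_) (∏-^ w m (λ i → e (suc i))))
                        (sym (^-distribˡ-+-* w (e zero) _))

∏-zero : (m : ℕ) (f : Fin m → ℕ) (j : Fin m) → f j ≡ 0 → ∏ m f ≡ 0
∏-zero (suc m) f zero    e = cong (_* ∏ m (λ i → f (suc i))) e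
∏-zero (suc m) f (suc j) e = trans (cong (f zero *_) (∏-zero m (λ i → f (suc i)) j e)) (*-zeroʳ (f zero))

∣-∏ : {p : ℕ} (m : ℕ) (f : Fin m → ℕ) (j : Fin m) → p ∣ f j → p ∣ ∏ m f
∣-∏ (suc m) f zero    h = ∣-trans h (m∣m*n _)
∣-∏ (suc m) f (suc j) h = ∣-trans (∣-∏ m (λ i → f (suc i)) j h) (n∣m*n (f zero))

prime∣∏⇒∣factor : {p : ℕ} → Prime p → (m : ℕ) (f : Fin m → ℕ) → p ∣ ∏ m f → ∃ λ j → p ∣ f j
prime∣∏⇒∣factor pp zero    f h = ⊥-elim (¬prime[1] (subst Prime (∣1⇒≡1 h) pp))
prime∣∏⇒∣factor pp (suc m) f h with euclidsLemma (f zero) _ pp h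
... | inj₁ h₀ = zero , h₀
... | inj₂ h₁ with prime∣∏⇒∣factor pp m (λ i → f (suc i)) h₁
...   | j , hj = suc j , hj

∏-∑-distrib : {A : Set} (m : ℕ) (ys : List A) (f : Fin m → A → ℕ) →
              ∏ m (λ j → ∑ ys (f j)) ≡ ∑ (choices m ys) (λ g → ∏ m (λ j → f j (g j)))
∏-∑-distrib zero    ys f = refl
∏-∑-distrib (suc m) ys f = begin
  ∑ ys (f zero) * ∏ m (λ j → ∑ ys (f (suc j)))
    ≡⟨ cong (∑ ys (f zero) *_) (∏-∑-distrib m ys (λ j → f (suc j))) ⟩
  ∑ ys (f zero) * ∑ (choices m ys) rest
    ≡⟨ *-comm (∑ ys (f zero)) _ ⟩
  ∑ (choices m ys) rest * ∑ ys (f zero)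
    ≡⟨ *-distribˡ-∑ (∑ (choices m ys) rest) ys (f zero) ⟩
  ∑ ys (λ y → ∑ (choices m ys) rest * f zero y)
    ≡⟨ ∑-cong ys (λ y → trans (*-comm _ (f zero y)) (*-distribˡ-∑ (f zero y) (choices m ys) rest)) ⟩
  ∑ ys (λ y → ∑ (choices m ys) (λ g → f zero y * rest g))
    ≡⟨ ∑-cong ys (λ y → sym (∑-map (y Vector.∷_) (choices m ys) F)) ⟩
  ∑ ys (λ y → ∑ (map (y Vector.∷_) (choices m ys)) F)
    ≡⟨ sym (∑-concatMap (λ y → map (y Vector.∷_) (choices m ys)) ys F) ⟩
  ∑ (choices (suc m) ys) F
    ∎
  where
  open ≡-Reasoning
  rest : (Fin m → _) → ℕ
  rest g = ∏ m (λ j → f (suc j) (g j))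
  F : (Fin (suc m) → _) → ℕ
  F g = ∏ (suc m) (λ j → f j (g j))

^-distribʳ-* : ∀ a b k → (a * b) ^ k ≡ a ^ k * b ^ k
^-distribʳ-* a b zero    = refl
^-distribʳ-* a b (suc k) = trans (cong (a * b *_) (^-distribʳ-* a b k)) (*-interchange a b (a ^ k) (b ^ k))

∃-≤-average : (m B : ℕ) (f : Fin m → ℕ) → 0 < m → sumFin m f ≤ B → ∃ λ i → m * f i ≤ B
∃-≤-average m B f 0<m ∑f≤B with Fin.any? (λ i → m * f i ≤? B)
... | yes found = found
... | no none = ⊥-elim (<⇒≱ (m<n+m (m * B) 0<m) (begin
  m + m * B                  ≡⟨ sym (*-suc m B) ⟩
  m * suc B                  ≡⟨ sym (sumFin-const m (suc B)) ⟩
  sumFin m (λ _ → suc B)     ≤⟨ sumFin-mono-≤ m (λ i → ≰⇒> (λ le → none (i , le))) ⟩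
  sumFin m (λ i → m * f i)   ≡⟨ sym (*-distribˡ-sumFin m m f) ⟩
  m * sumFin m f             ≤⟨ *-monoʳ-≤ m ∑f≤B ⟩
  m * B                      ∎))
  where open ≤-Reasoning

𝟙 : {A : Set} → Dec A → ℕ
𝟙 a? = if does a? then 1 else 0

𝟙-yes : {A : Set} (a? : Dec A) → A → 𝟙 a? ≡ 1
𝟙-yes a? a = cong (if_then 1 else 0) (dec-true a? a)

𝟙-no : {A : Set} (a? : Dec A) → ¬ A → 𝟙 a? ≡ 0
𝟙-no a? ¬a = cong (if_then 1 else 0) (dec-false a? ¬a)

𝟙≤1 : {A : Set} (a? : Dec A) → 𝟙 a? ≤ 1
𝟙≤1 (yes _) = s≤s z≤n
𝟙≤1 (no _)  = z≤n

sumFin-𝟙≟ : (m : ℕ) (t : Fin m) → sumFin m (λ ℓ → 𝟙 (t ≟ ℓ)) ≡ 1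
sumFin-𝟙≟ (suc m) zero    = cong suc (trans (sumFin-const m 0) (*-zeroʳ m))
sumFin-𝟙≟ (suc m) (suc t) = sumFin-𝟙≟ m t

∏-^𝟙≟ : (m : ℕ) (t : Fin m) (w : Fin m → ℕ) → ∏ m (λ ℓ → w ℓ ^ 𝟙 (t ≟ ℓ)) ≡ w t
∏-^𝟙≟ (suc m) zero    w = trans (cong (w zero * 1 *_) (∏-one m)) (trans (*-identityʳ _) (*-identityʳ _))
∏-^𝟙≟ (suc m) (suc t) w = trans (+-identityʳ _) (∏-^𝟙≟ m t (λ ℓ → w (suc ℓ)))

monomial : (n : ℕ) → (Fin n → ℕ) → (Fin n → ℕ) → ℕ
monomial n e w = ∏ n (λ k → w k ^ e k)

-- Over 𝔽_{q+1}, (a+1) + q w ≡ (a+1) − w, so ∏_{a<q} vanishes exactly when w ≢ 0.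
module SumZeroPolynomial (q d n : ℕ) where

  factor : Fin q → ℕ → ℕ
  factor a w = suc (toℕ a) + q * w

  coordinateSum : (Fin d → Fin n → ℕ) → Fin n → ℕ
  coordinateSum z k = sumFin d (λ ℓ → z ℓ k)

  P : (Fin d → Fin n → ℕ) → ℕ
  P z = ∏ n (λ k → ∏ q (λ a → factor a (coordinateSum z k)))

  -- Expanding factor a (Σ_ℓ w ℓ) = (a+1) + Σ_ℓ q w ℓ, a choice t = zero picks the
  -- constant and t = suc ℓ picks the term of colour ℓ.
  term : Fin q → Fin (suc d) → (Fin d → ℕ) → ℕ
  term a zero    w = suc (toℕ a)
  term a (suc ℓ) w = q * w ℓ

  lead : Fin (suc d) → Fin q → ℕ
  lead zero    a = suc (toℕ a)
  lead (suc _) a = 1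

  hits : Fin (suc d) → Fin d → ℕ
  hits zero    ℓ = 0
  hits (suc t) ℓ = 𝟙 (t ≟ ℓ)

  Choice : Set
  Choice = Fin n → Fin q → Fin (suc d)

  allChoices : List Choice
  allChoices = choices n (choices q (allFin (suc d)))

  exponent : Choice → Fin d → Fin n → ℕ
  exponent G ℓ k = sumFin q (λ a → hits (G k a) ℓ)

  degree : Choice → Fin d → ℕ
  degree G ℓ = sumFin n (exponent G ℓ)

  coeff : Choice → ℕ
  coeff G = ∏ n (λ k → ∏ q (λ a → lead (G k a) a)) * ∏ d (λ ℓ → ∏ n (λ k → q ^ exponent G ℓ k))

  factor-expand : (a : Fin q) (w : Fin d → ℕ) → factor a (sumFin d w) ≡ ∑ (allFin (suc d)) (λ t → term a t w)
  factor-expand a w = sym (trans (∑-allFin (suc d) (λ t → term a t w))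
                                 (cong (suc (toℕ a) +_) (sym (*-distribˡ-sumFin q d w))))

  term-split : (a : Fin q) (t : Fin (suc d)) (w : Fin d → ℕ) →
               term a t w ≡ lead t a * ∏ d (λ ℓ → (q * w ℓ) ^ hits t ℓ)
  term-split a zero    w = sym (trans (cong (suc (toℕ a) *_) (∏-one d)) (*-identityʳ _))
  term-split a (suc t) w = sym (trans (+-identityʳ _) (∏-^𝟙≟ d t (λ ℓ → q * w ℓ)))

  choice-product : (G : Choice) (z : Fin d → Fin n → ℕ) →
    ∏ n (λ k → ∏ q (λ a → term a (G k a) (λ ℓ → z ℓ k))) ≡ coeff G * ∏ d (λ ℓ → monomial n (exponent G ℓ) (z ℓ))
  choice-product G z = begin
    ∏ n (λ k → ∏ q (λ a → term a (G k a) (λ ℓ → z ℓ k)))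
      ≡⟨ ∏-cong n (λ k → trans (∏-cong q (λ a → term-split a (G k a) (λ ℓ → z ℓ k))) (∏-* q _ _)) ⟩
    ∏ n (λ k → ∏ q (λ a → lead (G k a) a) * ∏ q (λ a → ∏ d (λ ℓ → (q * z ℓ k) ^ hits (G k a) ℓ)))
      ≡⟨ ∏-* n _ _ ⟩
    L * ∏ n (λ k → ∏ q (λ a → ∏ d (λ ℓ → (q * z ℓ k) ^ hits (G k a) ℓ)))
      ≡⟨ cong (L *_) (∏-cong n (λ k → trans (∏-swap q d _) (∏-cong d (λ ℓ → ∏-^ (q * z ℓ k) q _)))) ⟩
    L * ∏ n (λ k → ∏ d (λ ℓ → (q * z ℓ k) ^ exponent G ℓ k))
      ≡⟨ cong (L *_) (∏-swap n d _) ⟩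
    L * ∏ d (λ ℓ → ∏ n (λ k → (q * z ℓ k) ^ exponent G ℓ k))
      ≡⟨ cong (L *_) (∏-cong d (λ ℓ → trans (∏-cong n (λ k → ^-distribʳ-* q (z ℓ k) (exponent G ℓ k))) (∏-* n _ _))) ⟩
    L * ∏ d (λ ℓ → ∏ n (λ k → q ^ exponent G ℓ k) * monomial n (exponent G ℓ) (z ℓ))
      ≡⟨ cong (L *_) (∏-* d _ _) ⟩
    L * (∏ d (λ ℓ → ∏ n (λ k → q ^ exponent G ℓ k)) * ∏ d (λ ℓ → monomial n (exponent G ℓ) (z ℓ)))
      ≡⟨ sym (*-assoc L _ _) ⟩
    coeff G * ∏ d (λ ℓ → monomial n (exponent G ℓ) (z ℓ))
      ∎
    where
    open ≡-Reasoning
    L : ℕ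
    L = ∏ n (λ k → ∏ q (λ a → lead (G k a) a))

  P-expand : (z : Fin d → Fin n → ℕ) →
             P z ≡ ∑ allChoices (λ G → coeff G * ∏ d (λ ℓ → monomial n (exponent G ℓ) (z ℓ)))
  P-expand z = begin
    P z
      ≡⟨ ∏-cong n (λ k → ∏-cong q (λ a → factor-expand a (λ ℓ → z ℓ k))) ⟩
    ∏ n (λ k → ∏ q (λ a → ∑ (allFin (suc d)) (λ t → term a t (λ ℓ → z ℓ k))))
      ≡⟨ ∏-cong n (λ k → ∏-∑-distrib q (allFin (suc d)) (λ a t → term a t (λ ℓ → z ℓ k))) ⟩
    ∏ n (λ k → ∑ (choices q (allFin (suc d))) (λ g → ∏ q (λ a → term a (g a) (λ ℓ → z ℓ k))))
      ≡⟨ ∏-∑-distrib n (choices q (allFin (suc d))) (λ k g → ∏ q (λ a → term a (g a) (λ ℓ → z ℓ k))) ⟩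
    ∑ allChoices (λ G → ∏ n (λ k → ∏ q (λ a → term a (G k a) (λ ℓ → z ℓ k))))
      ≡⟨ ∑-cong allChoices (λ G → choice-product G z) ⟩
    ∑ allChoices (λ G → coeff G * ∏ d (λ ℓ → monomial n (exponent G ℓ) (z ℓ)))
      ∎
    where open ≡-Reasoning

  hits≤1 : (t : Fin (suc d)) (ℓ : Fin d) → hits t ℓ ≤ 1
  hits≤1 zero    ℓ = z≤n
  hits≤1 (suc t) ℓ = 𝟙≤1 (t ≟ ℓ)

  exponent≤q : (G : Choice) (ℓ : Fin d) (k : Fin n) → exponent G ℓ k ≤ q
  exponent≤q G ℓ k = ≤-trans (sumFin-mono-≤ q (λ a → hits≤1 (G k a) ℓ))
                             (≤-reflexive (trans (sumFin-const q 1) (*-identityʳ q)))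

  sumFin-hits≤1 : (t : Fin (suc d)) → sumFin d (hits t) ≤ 1
  sumFin-hits≤1 zero    = ≤-trans (≤-reflexive (trans (sumFin-const d 0) (*-zeroʳ d))) z≤n
  sumFin-hits≤1 (suc t) = ≤-reflexive (sumFin-𝟙≟ d t)

  total-degree≤ : (G : Choice) → sumFin d (degree G) ≤ q * n
  total-degree≤ G = begin
    sumFin d (λ ℓ → sumFin n (λ k → sumFin q (λ a → hits (G k a) ℓ)))
      ≡⟨ sumFin-swap d n _ ⟩
    sumFin n (λ k → sumFin d (λ ℓ → sumFin q (λ a → hits (G k a) ℓ)))
      ≡⟨ sumFin-cong n (λ k → sumFin-swap d q _) ⟩
    sumFin n (λ k → sumFin q (λ a → sumFin d (hits (G k a))))
      ≤⟨ sumFin-mono-≤ n (λ k → sumFin-mono-≤ q (λ a → sumFin-hits≤1 (G k a))) ⟩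
    sumFin n (λ k → sumFin q (λ a → 1))
      ≡⟨ trans (sumFin-const n _) (cong (n *_) (trans (sumFin-const q 1) (*-identityʳ q))) ⟩
    n * q
      ≡⟨ *-comm n q ⟩
    q * n
      ∎
    where open ≤-Reasoning

  factor-divisible : (w : ℕ) → ¬ suc q ∣ w → ∃ λ a → suc q ∣ factor a w
  factor-divisible w p∤w with w % suc q in r≡ | m%n<n w (suc q)
  ... | zero   | _   = ⊥-elim (p∤w (divides (w / suc q) (trans (m≡m%n+[m/n]*n w (suc q)) (cong (_+ w / suc q * suc q) r≡))))
  ... | suc r | r<p = fromℕ< (s≤s⁻¹ r<p) , divides (suc r + q * (w / suc q)) (begin
    suc (toℕ (fromℕ< (s≤s⁻¹ r<p))) + q * w
      ≡⟨ cong (λ i → suc i + q * w) (Fin.toℕ-fromℕ< (s≤s⁻¹ r<p)) ⟩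
    suc r + q * w
      ≡⟨ cong (λ v → suc r + q * v) (trans (m≡m%n+[m/n]*n w (suc q)) (cong (_+ w / suc q * suc q) r≡)) ⟩
    suc r + q * (suc r + w / suc q * suc q)
      ≡⟨ regroup r q (w / suc q) ⟩
    (suc r + q * (w / suc q)) * suc q
      ∎)
    where
    open ≡-Reasoning
    regroup : ∀ r q t → suc r + q * (suc r + t * suc q) ≡ (suc r + q * t) * suc q
    regroup = solve-∀

  factor-coprime : Prime (suc q) → (a : Fin q) (w : ℕ) → suc q ∣ w → ¬ suc q ∣ factor a w
  factor-coprime _ a w p∣w p∣f =
    <⇒≱ (s≤s (Fin.toℕ<n a)) (∣⇒≤ (∣m+n∣m⇒∣n (subst (suc q ∣_) (+-comm (suc (toℕ a)) (q * w)) p∣f) (∣-trans p∣w (n∣m*n q))))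

  P-divisible : (z : Fin d → Fin n → ℕ) (k : Fin n) → ¬ suc q ∣ coordinateSum z k → suc q ∣ P z
  P-divisible z k p∤s with factor-divisible (coordinateSum z k) p∤s
  ... | a , p∣f = ∣-∏ n _ k (∣-∏ q _ a p∣f)

  P-coprime : Prime (suc q) → (z : Fin d → Fin n → ℕ) → (∀ k → suc q ∣ coordinateSum z k) → ¬ suc q ∣ P z
  P-coprime pp z p∣s p∣P with prime∣∏⇒∣factor pp n _ p∣P
  ... | k , p∣∏ with prime∣∏⇒∣factor pp q _ p∣∏
  ...   | a , p∣f = factor-coprime pp a (coordinateSum z k) (p∣s k) p∣f

  lowDegreeColour : 3 ≤ d → (G : Choice) → ∃ λ ℓ → 3 * degree G ℓ ≤ q * n
  lowDegreeColour 3≤d G with ∃-≤-average d (q * n) (degree G) (≤-trans (s≤s z≤n) 3≤d) (total-degree≤ G)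
  ... | ℓ , d*deg≤ = ℓ , ≤-trans (*-monoˡ-≤ (degree G ℓ) 3≤d) d*deg≤

  module _ (N : ℕ) (y : Fin d → Fin N → Fin n → ℕ) (c : Fin d → Fin N → ℕ) where

    weightedSum : ℕ
    weightedSum = ∑ (choices d (allFin N)) (λ ι → ∏ d (λ ℓ → c ℓ (ι ℓ)) * P (λ ℓ → y ℓ (ι ℓ)))

    colourSum : Choice → Fin d → ℕ
    colourSum G ℓ = ∑ (allFin N) (λ i → c ℓ i * monomial n (exponent G ℓ) (y ℓ i))

    weightedSum-expand : weightedSum ≡ ∑ allChoices (λ G → coeff G * ∏ d (colourSum G))
    weightedSum-expand = begin
      ∑ ιs (λ ι → w ι * P (λ ℓ → y ℓ (ι ℓ)))
        ≡⟨ ∑-cong ιs (λ ι → trans (cong (w ι *_) (P-expand (λ ℓ → y ℓ (ι ℓ)))) (*-distribˡ-∑ (w ι) allChoices _)) ⟩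
      ∑ ιs (λ ι → ∑ allChoices (λ G → w ι * (coeff G * m G ι)))
        ≡⟨ ∑-swap ιs allChoices _ ⟩
      ∑ allChoices (λ G → ∑ ιs (λ ι → w ι * (coeff G * m G ι)))
        ≡⟨ ∑-cong allChoices (λ G → trans (∑-cong ιs (λ ι → pull-out G ι)) (sym (*-distribˡ-∑ (coeff G) ιs _))) ⟩
      ∑ allChoices (λ G → coeff G * ∑ ιs (λ ι → ∏ d (λ ℓ → c ℓ (ι ℓ) * monomial n (exponent G ℓ) (y ℓ (ι ℓ)))))
        ≡⟨ ∑-cong allChoices (λ G → cong (coeff G *_) (sym (∏-∑-distrib d (allFin N) _))) ⟩
      ∑ allChoices (λ G → coeff G * ∏ d (colourSum G))
        ∎
      where
      open ≡-Reasoning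
      ιs : List (Fin d → Fin N)
      ιs = choices d (allFin N)
      w : (Fin d → Fin N) → ℕ
      w ι = ∏ d (λ ℓ → c ℓ (ι ℓ))
      m : Choice → (Fin d → Fin N) → ℕ
      m G ι = ∏ d (λ ℓ → monomial n (exponent G ℓ) (y ℓ (ι ℓ)))
      *-comm-middle : ∀ a b e → a * (b * e) ≡ b * (a * e)
      *-comm-middle = solve-∀
      pull-out : ∀ G ι → w ι * (coeff G * m G ι) ≡ coeff G * ∏ d (λ ℓ → c ℓ (ι ℓ) * monomial n (exponent G ℓ) (y ℓ (ι ℓ)))
      pull-out G ι = trans (*-comm-middle (w ι) (coeff G) (m G ι)) (cong (coeff G *_) (sym (∏-* d _ _)))

    weightedSum-divisible : 3 ≤ d →
      (∀ ℓ (e : Fin n → ℕ) → (∀ k → e k ≤ q) → 3 * sumFin n e ≤ q * n →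
         suc q ∣ ∑ (allFin N) (λ i → c ℓ i * monomial n e (y ℓ i))) →
      suc q ∣ weightedSum
    weightedSum-divisible 3≤d annihilates =
      subst (suc q ∣_) (sym weightedSum-expand) (∣-∑ allChoices _ divisible)
      where
      divisible : ∀ G → suc q ∣ coeff G * ∏ d (colourSum G)
      divisible G with lowDegreeColour 3≤d G
      ... | ℓ , low = ∣-trans (∣-∏ d (colourSum G) ℓ (annihilates ℓ (exponent G ℓ) (exponent≤q G ℓ) low)) (n∣m*n (coeff G))

  P-cong : {z z′ : Fin d → Fin n → ℕ} → (∀ ℓ k → z ℓ k ≡ z′ ℓ k) → P z ≡ P z′
  P-cong z≗z′ = ∏-cong n (λ k → cong (λ w → ∏ q (λ a → factor a w)) (sumFin-cong d (λ ℓ → z≗z′ ℓ k)))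

argmax : (m : ℕ) (P : Fin m → Set) → (∀ i → Dec (P i)) → (κ : Fin m → ℕ) →
         (∀ i → ¬ P i) ⊎ ∃ λ i → P i × (∀ j → P j → κ j ≤ κ i)
argmax zero    P P? κ = inj₁ (λ ())
argmax (suc m) P P? κ with argmax m (λ i → P (suc i)) (λ i → P? (suc i)) (λ i → κ (suc i)) | P? zero
... | inj₁ none | no ¬P₀ = inj₁ λ { zero → ¬P₀ ; (suc i) → none i }
... | inj₁ none | yes P₀ = inj₂ (zero , P₀ , λ { zero _ → ≤-refl ; (suc j) Pj → ⊥-elim (none j Pj) })
... | inj₂ (i , Pi , max) | no ¬P₀ =
  inj₂ (suc i , Pi , λ { zero P₀ → ⊥-elim (¬P₀ P₀) ; (suc j) Pj → max j Pj })
... | inj₂ (i , Pi , max) | yes P₀ with κ zero ≤? κ (suc i)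
...   | yes κ₀≤ = inj₂ (suc i , Pi , λ { zero _ → κ₀≤ ; (suc j) Pj → max j Pj })
...   | no κ₀≰  = inj₂ (zero , P₀ , λ { zero _ → ≤-refl ; (suc j) Pj → ≤-trans (max j Pj) (<⇒≤ (≰⇒> κ₀≰)) })

-- Gaussian elimination over 𝔽_p, p = q + 1, always pivoting on the κ-largest coordinate.
module TriangularAnnihilators (q N : ℕ) (pp : Prime (suc q)) (κ : Fin N → ℕ) (κ-injective : Injective _≡_ _≡_ κ) where

  open import Data.List.Membership.DecPropositional (_≟_ {N}) using (_∈?_)

  dot : (Fin N → ℕ) → (Fin N → ℕ) → ℕ
  dot c f = ∑ (allFin N) (λ i → c i * f i)

  record Annihilator (fs : List (Fin N → ℕ)) (a : Fin N) (c : Fin N → ℕ) : Set where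
    field
      pivot : ¬ suc q ∣ c a
      upper : ∀ b → κ b < κ a → c b ≡ 0
      kills : ∀ f → f ∈ fs → suc q ∣ dot c f

  open Annihilator

  dot-combine : (v w : ℕ) (c c′ f : Fin N → ℕ) →
                dot (λ i → v * c i + q * (w * c′ i)) f ≡ v * dot c f + q * (w * dot c′ f)
  dot-combine v w c c′ f = begin
    ∑ (allFin N) (λ i → (v * c i + q * (w * c′ i)) * f i)
      ≡⟨ ∑-cong (allFin N) (λ i → expand q v (c i) w (c′ i) (f i)) ⟩
    ∑ (allFin N) (λ i → v * (c i * f i) + q * (w * (c′ i * f i)))
      ≡⟨ ∑-+ (allFin N) _ _ ⟩
    ∑ (allFin N) (λ i → v * (c i * f i)) + ∑ (allFin N) (λ i → q * (w * (c′ i * f i)))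
      ≡⟨ sym (cong₂ _+_ (*-distribˡ-∑ v (allFin N) _)
                        (trans (cong (q *_) (*-distribˡ-∑ w (allFin N) _)) (*-distribˡ-∑ q (allFin N) _))) ⟩
    v * dot c f + q * (w * dot c′ f)
      ∎
    where
    open ≡-Reasoning
    expand : ∀ q v a w b g → (v * a + q * (w * b)) * g ≡ v * (a * g) + q * (w * (b * g))
    expand = solve-∀

  extend : ∀ {fs f a c} → Annihilator fs a c → suc q ∣ dot c f → Annihilator (f ∷ fs) a c
  extend old p∣cf = record
    { pivot = pivot old
    ; upper = upper old
    ; kills = λ { g (here refl) → p∣cf ; g (there g∈) → kills old g g∈ } }

  combine : ∀ {fs f a a* c c*} → Annihilator fs a c → Annihilator fs a* c* → κ a < κ a* → ¬ suc q ∣ dot c* f →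
            Annihilator (f ∷ fs) a (λ b → dot c* f * c b + q * (dot c f * c* b))
  combine {fs} {f} {a} {a*} {c} {c*} old old* κa<κa* p∤v = record { pivot = pivot′ ; upper = upper′ ; kills = kills′ }
    where
    u v : ℕ
    u = dot c f
    v = dot c* f
    pivot′ : ¬ suc q ∣ v * c a + q * (u * c* a)
    pivot′ p∣ with euclidsLemma v (c a) pp (subst (suc q ∣_) drop-zero p∣)
      where
      drop-zero : v * c a + q * (u * c* a) ≡ v * c a
      drop-zero rewrite upper old* a κa<κa* | *-zeroʳ u | *-zeroʳ q = +-identityʳ _
    ... | inj₁ p∣v = p∤v p∣v
    ... | inj₂ p∣c = pivot old p∣c
    upper′ : ∀ b → κ b < κ a → v * c b + q * (u * c* b) ≡ 0
    upper′ b κb<κa rewrite upper old b κb<κa | upper old* b (<-trans κb<κa κa<κa*)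
                         | *-zeroʳ v | *-zeroʳ u | *-zeroʳ q = refl
    -- q ≡ −1 (mod p), so on f the combination is p · u v.
    cancel : ∀ q v u → v * u + q * (u * v) ≡ suc q * (u * v)
    cancel = solve-∀
    kills′ : ∀ g → g ∈ f ∷ fs → suc q ∣ dot (λ b → v * c b + q * (u * c* b)) g
    kills′ g (here refl)  = subst (suc q ∣_) (sym (trans (dot-combine v u c c* g) (cancel q v u))) (m∣m*n (u * v))
    kills′ g (there g∈fs) = subst (suc q ∣_) (sym (dot-combine v u c c* g))
                              (∣m∣n⇒∣m+n (∣-trans (kills old g g∈fs) (n∣m*n v))
                                         (∣-trans (∣-trans (kills old* g g∈fs) (n∣m*n u)) (n∣m*n q)))

  annihilators : (fs : List (Fin N → ℕ)) →
    ∃ λ (L : List (Fin N)) → length L ≤ length fs ×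
      ∃ λ (C : Fin N → Fin N → ℕ) → ∀ a → ¬ a ∈ L → Annihilator fs a (C a)
  annihilators [] = [] , z≤n , (λ a b → 𝟙 (a ≟ b)) , λ a _ → record
    { pivot = subst (λ x → ¬ suc q ∣ x) (sym (𝟙-yes (a ≟ a) refl)) p∤1
    ; upper = λ b κb<κa → 𝟙-no (a ≟ b) (λ a≡b → <-irrefl (cong κ (sym a≡b)) κb<κa)
    ; kills = λ f () }
    where
    p∤1 : ¬ suc q ∣ 1
    p∤1 p∣1 = ¬prime[1] (subst Prime (∣1⇒≡1 p∣1) pp)
  annihilators (f ∷ fs) with annihilators fs
  ... | L , |L|≤ , C , ann with argmax N (λ a → ¬ a ∈ L × ¬ suc q ∣ dot (C a) f) newPivot? κ
    where
    newPivot? : ∀ a → Dec (¬ a ∈ L × ¬ suc q ∣ dot (C a) f)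
    newPivot? a = ¬? (a ∈? L) ×-dec ¬? (suc q ∣? dot (C a) f)
  ... | inj₁ none = L , m≤n⇒m≤1+n |L|≤ , C , λ a a∉L →
          extend (ann a a∉L) (decidable-stable (suc q ∣? dot (C a) f) (λ p∤ → none a (a∉L , p∤)))
  ... | inj₂ (a* , (a*∉L , p∤a*) , maximal) = a* ∷ L , s≤s |L|≤ , C′ , ann′
    where
    C′ : Fin N → Fin N → ℕ
    C′ a with suc q ∣? dot (C a) f
    ... | yes _ = C a
    ... | no _  = λ b → dot (C a*) f * C a b + q * (dot (C a) f * C a* b)
    ann′ : ∀ a → ¬ a ∈ a* ∷ L → Annihilator (f ∷ fs) a (C′ a)
    ann′ a a∉L′ with suc q ∣? dot (C a) f | (λ a∈L → a∉L′ (there a∈L))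
    ... | yes p∣u | a∉L = extend (ann a a∉L) p∣u
    ... | no p∤u  | a∉L = combine (ann a a∉L) (ann a* a*∉L) κa<κa* p∤a*
      where
      κa<κa* : κ a < κ a*
      κa<κa* = ≤∧≢⇒< (maximal a (a∉L , p∤u)) (λ e → a∉L′ (here (κ-injective e)))

module ExponentVectors (q : ℕ) where

  branch : {n : ℕ} {D : ℕ} (y : Fin (suc q)) → Dec (toℕ y ≤ D) →
           List (Fin n → Fin (suc q)) → List (Fin (suc n) → Fin (suc q))
  branch y (yes _) es = map (y Vector.∷_) es
  branch y (no _)  es = []

  ofDegree≤ : (n D : ℕ) → List (Fin n → Fin (suc q))
  ofDegree≤ zero    D = (λ ()) ∷ []
  ofDegree≤ (suc n) D = concatMap (λ y → branch y (toℕ y ≤? D) (ofDegree≤ n (D ∸ toℕ y))) (allFin (suc q))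

  ofDegree≤-complete : (n D : ℕ) (e : Fin n → ℕ) → (∀ k → e k ≤ q) → sumFin n e ≤ D →
                     ∃ λ e′ → e′ ∈ ofDegree≤ n D × (∀ k → toℕ (e′ k) ≡ e k)
  ofDegree≤-complete zero    D e _   _    = (λ ()) , here refl , λ ()
  ofDegree≤-complete (suc n) D e e≤q Σe≤D
    with ofDegree≤-complete n (D ∸ e zero) (λ k → e (suc k)) (λ k → e≤q (suc k)) tail≤
    where
    tail≤ : sumFin n (λ k → e (suc k)) ≤ D ∸ e zero
    tail≤ = subst (_≤ D ∸ e zero) (m+n∸m≡n (e zero) _) (∸-monoˡ-≤ (e zero) Σe≤D)
  ... | e′ , e′∈ , e′≗ = y Vector.∷ e′ , ∈-concatMap⁺ _ (lose (∈-allFin y) y∷e′∈) , λ { zero → toℕ-y ; (suc k) → e′≗ k }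
    where
    y : Fin (suc q)
    y = fromℕ< (s≤s (e≤q zero))
    toℕ-y : toℕ y ≡ e zero
    toℕ-y = Fin.toℕ-fromℕ< (s≤s (e≤q zero))
    y∷e′∈ : y Vector.∷ e′ ∈ branch y (toℕ y ≤? D) (ofDegree≤ n (D ∸ toℕ y))
    y∷e′∈ with toℕ y ≤? D
    ... | yes _  = ∈-map⁺ (y Vector.∷_) (subst (λ t → e′ ∈ ofDegree≤ n (D ∸ t)) (sym toℕ-y) e′∈)
    ... | no y≰D = ⊥-elim (y≰D (subst (_≤ D) (sym toℕ-y) (≤-trans (m≤m+n _ _) Σe≤D)))

  -- Rankin's trick: Σ_{Σe ≤ D} 1 ≤ Σ_e (X/Y)^(D − Σe), and the right side factorises.
  module Rankin (X Y : ℕ) (Y≤X : Y ≤ X) where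

    Q : ℕ
    Q = ∑ (allFin (suc q)) (λ y → Y ^ toℕ y * X ^ (q ∸ toℕ y))

    rankin-step : ∀ L A B D′ y r → L * Y ^ D′ * B ≤ X ^ D′ * A →
                  L * Y ^ (D′ + y) * (X ^ (y + r) * B) ≤ X ^ (D′ + y) * A * (Y ^ y * X ^ r)
    rankin-step L A B D′ y r IH = begin
      L * Y ^ (D′ + y) * (X ^ (y + r) * B)
        ≡⟨ cong₂ (λ a b → L * a * (b * B)) (^-distribˡ-+-* Y D′ y) (^-distribˡ-+-* X y r) ⟩
      L * (Y ^ D′ * Y ^ y) * (X ^ y * X ^ r * B)
        ≡⟨ regroupˡ L (Y ^ D′) (Y ^ y) (X ^ y) (X ^ r) B ⟩
      L * Y ^ D′ * B * (X ^ y * (Y ^ y * X ^ r))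
        ≤⟨ *-monoˡ-≤ _ IH ⟩
      X ^ D′ * A * (X ^ y * (Y ^ y * X ^ r))
        ≡⟨ regroupʳ (X ^ D′) A (X ^ y) (Y ^ y * X ^ r) ⟩
      X ^ D′ * X ^ y * A * (Y ^ y * X ^ r)
        ≡⟨ cong (λ a → a * A * (Y ^ y * X ^ r)) (sym (^-distribˡ-+-* X D′ y)) ⟩
      X ^ (D′ + y) * A * (Y ^ y * X ^ r)
        ∎
      where
      open ≤-Reasoning
      regroupˡ : ∀ l a b c d e → l * (a * b) * (c * d * e) ≡ l * a * e * (c * (b * d))
      regroupˡ = solve-∀
      regroupʳ : ∀ a b c d → a * b * (c * d) ≡ a * c * b * d
      regroupʳ = solve-∀

    branch-bound : (n D : ℕ) (y : Fin (suc q)) →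
      length (ofDegree≤ n (D ∸ toℕ y)) * Y ^ (D ∸ toℕ y) * X ^ (q * n) ≤ X ^ (D ∸ toℕ y) * Q ^ n →
      length (branch y (toℕ y ≤? D) (ofDegree≤ n (D ∸ toℕ y))) * Y ^ D * X ^ (q * suc n)
        ≤ X ^ D * Q ^ n * (Y ^ toℕ y * X ^ (q ∸ toℕ y))
    branch-bound n D y IH with toℕ y ≤? D
    ... | no _    = z≤n
    ... | yes y≤D = subst₂ _≤_ lhs≡ rhs≡ (rankin-step L (Q ^ n) (X ^ (q * n)) D′ y′ (q ∸ y′) IH)
      where
      y′ D′ L : ℕ
      y′ = toℕ y
      D′ = D ∸ y′
      L = length (ofDegree≤ n D′)
      D≡ : D′ + y′ ≡ D
      D≡ = m∸n+n≡m y≤D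
      X^q*suc-n : X ^ (y′ + (q ∸ y′)) * X ^ (q * n) ≡ X ^ (q * suc n)
      X^q*suc-n = begin
        X ^ (y′ + (q ∸ y′)) * X ^ (q * n) ≡⟨ cong (λ c → X ^ c * X ^ (q * n)) (m+[n∸m]≡n (s≤s⁻¹ (Fin.toℕ<n y))) ⟩
        X ^ q * X ^ (q * n)               ≡⟨ sym (^-distribˡ-+-* X q (q * n)) ⟩
        X ^ (q + q * n)                   ≡⟨ cong (X ^_) (sym (*-suc q n)) ⟩
        X ^ (q * suc n)                   ∎
        where open ≡-Reasoning
      lhs≡ : L * Y ^ (D′ + y′) * (X ^ (y′ + (q ∸ y′)) * X ^ (q * n))
             ≡ length (map (y Vector.∷_) (ofDegree≤ n D′)) * Y ^ D * X ^ (q * suc n)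
      lhs≡ = trans (cong₂ (λ a b → a * Y ^ b * (X ^ (y′ + (q ∸ y′)) * X ^ (q * n)))
                            (sym (length-map (y Vector.∷_) (ofDegree≤ n D′))) D≡)
                     (cong (length (map (y Vector.∷_) (ofDegree≤ n D′)) * Y ^ D *_) X^q*suc-n)
      rhs≡ : X ^ (D′ + y′) * Q ^ n * (Y ^ y′ * X ^ (q ∸ y′)) ≡ X ^ D * Q ^ n * (Y ^ y′ * X ^ (q ∸ y′))
      rhs≡ = cong (λ a → X ^ a * Q ^ n * (Y ^ y′ * X ^ (q ∸ y′))) D≡

    length-ofDegree≤ : (n D : ℕ) → length (ofDegree≤ n D) * Y ^ D * X ^ (q * n) ≤ X ^ D * Q ^ n
    length-ofDegree≤ zero    D = subst₂ _≤_ (sym (trans (cong (λ e → 1 * Y ^ D * X ^ e) (*-zeroʳ q)) (*-identityʳ _)))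
                                          (sym (*-identityʳ _)) (subst (_≤ X ^ D) (sym (+-identityʳ _)) (^-monoˡ-≤ D Y≤X))
    length-ofDegree≤ (suc n) D = begin
      length (ofDegree≤ (suc n) D) * Y ^ D * X ^ (q * suc n)
        ≡⟨ cong (λ l → l * Y ^ D * X ^ (q * suc n)) (length-concatMap branches (allFin (suc q))) ⟩
      ∑ (allFin (suc q)) (λ y → length (branches y)) * Y ^ D * X ^ (q * suc n)
        ≡⟨ trans (*-assoc (∑ (allFin (suc q)) (λ y → length (branches y))) (Y ^ D) (X ^ (q * suc n)))
                 (trans (*-comm _ (Y ^ D * X ^ (q * suc n)))
                        (*-distribˡ-∑ (Y ^ D * X ^ (q * suc n)) (allFin (suc q)) (λ y → length (branches y)))) ⟩
      ∑ (allFin (suc q)) (λ y → Y ^ D * X ^ (q * suc n) * length (branches y))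
        ≤⟨ ∑-mono-≤ (allFin (suc q)) (λ y → ≤-trans (≤-reflexive (rotate (Y ^ D) (X ^ (q * suc n)) (length (branches y))))
                                         (branch-bound n D y (length-ofDegree≤ n (D ∸ toℕ y)))) ⟩
      ∑ (allFin (suc q)) (λ y → X ^ D * Q ^ n * (Y ^ toℕ y * X ^ (q ∸ toℕ y)))
        ≡⟨ sym (*-distribˡ-∑ (X ^ D * Q ^ n) (allFin (suc q)) _) ⟩
      X ^ D * Q ^ n * Q
        ≡⟨ trans (*-assoc (X ^ D) _ _) (cong (X ^ D *_) (*-comm (Q ^ n) Q)) ⟩
      X ^ D * Q ^ suc n
        ∎
      where
      open ≤-Reasoning
      branches : Fin (suc q) → List (Fin (suc n) → Fin (suc q))
      branches y = branch y (toℕ y ≤? D) (ofDegree≤ n (D ∸ toℕ y))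
      rotate : ∀ a b c → a * b * c ≡ c * a * b
      rotate a b c = trans (*-comm (a * b) c) (sym (*-assoc c a b))

module GeometricSum (X Y : ℕ) where

  geom : ℕ → ℕ
  geom zero    = 1
  geom (suc m) = X ^ suc m + Y * geom m

  sumFin≡geom : ∀ m → sumFin (suc m) (λ y → Y ^ toℕ y * X ^ (m ∸ toℕ y)) ≡ geom m
  sumFin≡geom zero    = refl
  sumFin≡geom (suc m) = cong₂ _+_ (*-identityˡ (X ^ suc m)) (begin
    sumFin (suc m) (λ y → Y * Y ^ toℕ y * X ^ (m ∸ toℕ y))   ≡⟨ sumFin-cong (suc m) (λ y → *-assoc Y (Y ^ toℕ y) (X ^ (m ∸ toℕ y))) ⟩
    sumFin (suc m) (λ y → Y * (Y ^ toℕ y * X ^ (m ∸ toℕ y))) ≡⟨ sym (*-distribˡ-sumFin Y (suc m) (λ y → Y ^ toℕ y * X ^ (m ∸ toℕ y))) ⟩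
    Y * sumFin (suc m) (λ y → Y ^ toℕ y * X ^ (m ∸ toℕ y))   ≡⟨ cong (Y *_) (sumFin≡geom m) ⟩
    Y * geom m                                                ∎)
    where open ≡-Reasoning

  X^m≤geom : ∀ m → X ^ m ≤ geom m
  X^m≤geom zero    = ≤-refl
  X^m≤geom (suc m) = m≤m+n _ _

  module _ (δ : ℕ) (X≡Y+δ : X ≡ Y + δ) where

    Y≤X : Y ≤ X
    Y≤X = subst (Y ≤_) (sym X≡Y+δ) (m≤m+n Y δ)

    Y*X^m≤ : ∀ m → Y * X ^ m ≤ Y ^ suc m + m * δ * X ^ m
    Y*X^m≤ zero    = ≤-reflexive (sym (+-identityʳ (Y * 1)))
    Y*X^m≤ (suc m) = begin
      Y * (X * X ^ m)                                  ≡⟨ *-comm-middle Y X (X ^ m) ⟩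
      X * (Y * X ^ m)                                  ≤⟨ *-monoʳ-≤ X (Y*X^m≤ m) ⟩
      X * (Y ^ suc m + m * δ * X ^ m)                  ≡⟨ cong (λ x → x * (Y ^ suc m + m * δ * X ^ m)) X≡Y+δ ⟩
      (Y + δ) * (Y ^ suc m + m * δ * X ^ m)            ≡⟨ distribute Y δ (Y ^ suc m) m (X ^ m) ⟩
      Y ^ suc (suc m) + δ * Y ^ suc m + m * δ * ((Y + δ) * X ^ m)
        ≡⟨ cong (λ x → Y ^ suc (suc m) + δ * Y ^ suc m + m * δ * (x * X ^ m)) (sym X≡Y+δ) ⟩
      Y ^ suc (suc m) + δ * Y ^ suc m + m * δ * X ^ suc m
        ≤⟨ +-monoˡ-≤ _ (+-monoʳ-≤ (Y ^ suc (suc m)) (*-monoʳ-≤ δ (^-monoˡ-≤ (suc m) Y≤X))) ⟩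
      Y ^ suc (suc m) + δ * X ^ suc m + m * δ * X ^ suc m  ≡⟨ collect (Y ^ suc (suc m)) δ m (X ^ suc m) ⟩
      Y ^ suc (suc m) + suc m * δ * X ^ suc m              ∎
      where
      open ≤-Reasoning
      *-comm-middle : ∀ y x a → y * (x * a) ≡ x * (y * a)
      *-comm-middle = solve-∀
      distribute : ∀ y d a m b → (y + d) * (a + m * d * b) ≡ y * a + d * a + m * d * ((y + d) * b)
      distribute = solve-∀
      collect : ∀ a d m b → a + d * b + m * d * b ≡ a + (1 + m) * d * b
      collect = solve-∀

    weighted-AM-GM : ∀ m → suc m * (Y * X ^ m) ≤ m * X ^ suc m + Y ^ suc m
    weighted-AM-GM m = begin
      suc m * (Y * X ^ m)                       ≡⟨ +-comm (Y * X ^ m) _ ⟩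
      m * (Y * X ^ m) + Y * X ^ m               ≤⟨ +-monoʳ-≤ (m * (Y * X ^ m)) (Y*X^m≤ m) ⟩
      m * (Y * X ^ m) + (Y ^ suc m + m * δ * X ^ m) ≡⟨ regroup m Y (X ^ m) (Y ^ suc m) δ ⟩
      m * ((Y + δ) * X ^ m) + Y ^ suc m         ≡⟨ cong (λ x → m * (x * X ^ m) + Y ^ suc m) (sym X≡Y+δ) ⟩
      m * X ^ suc m + Y ^ suc m                 ∎
      where
      open ≤-Reasoning
      regroup : ∀ m y a c d → m * (y * a) + (c + m * d * a) ≡ m * ((y + d) * a) + c
      regroup = solve-∀

    -- Pairing the terms Y^y X^(m−y) and Y^(m−y) X^y of the geometric sum.
    2*geom≤ : ∀ m → 2 * geom m ≤ suc m * (X ^ m + Y ^ m)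
    2*geom≤ zero    = ≤-refl
    2*geom≤ (suc m) = begin
      2 * (X ^ suc m + Y * geom m)                              ≡⟨ distribute (X ^ suc m) Y (geom m) ⟩
      2 * X ^ suc m + Y * (2 * geom m)                          ≤⟨ +-monoʳ-≤ (2 * X ^ suc m) (*-monoʳ-≤ Y (2*geom≤ m)) ⟩
      2 * X ^ suc m + Y * (suc m * (X ^ m + Y ^ m))             ≡⟨ expand (X ^ suc m) Y m (X ^ m) (Y ^ m) ⟩
      2 * X ^ suc m + suc m * (Y * X ^ m) + suc m * (Y * Y ^ m) ≤⟨ +-monoˡ-≤ _ (+-monoʳ-≤ (2 * X ^ suc m) (weighted-AM-GM m)) ⟩
      2 * X ^ suc m + (m * X ^ suc m + Y ^ suc m) + suc m * Y ^ suc m ≡⟨ collect (X ^ suc m) m (Y ^ suc m) ⟩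
      suc (suc m) * (X ^ suc m + Y ^ suc m)                     ∎
      where
      open ≤-Reasoning
      distribute : ∀ a y g → 2 * (a + y * g) ≡ 2 * a + y * (2 * g)
      distribute = solve-∀
      expand : ∀ a y m b c → 2 * a + y * ((1 + m) * (b + c)) ≡ 2 * a + (1 + m) * (y * b) + (1 + m) * (y * c)
      expand = solve-∀
      collect : ∀ a m c → 2 * a + (m * a + c) + (1 + m) * c ≡ (2 + m) * (a + c)
      collect = solve-∀

r*suc-r^k≤ : ∀ r k → 2 * k ≤ r → r * suc r ^ k ≤ r ^ k * (r + 2 * k)
r*suc-r^k≤ r zero    _    = ≤-reflexive (trans (*-identityʳ r) (sym (trans (*-identityˡ _) (+-identityʳ r))))
r*suc-r^k≤ r (suc k) 2k≤r = begin
  r * (suc r * suc r ^ k)            ≡⟨ *-comm-middle r (suc r) (suc r ^ k) ⟩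
  suc r * (r * suc r ^ k)            ≤⟨ *-monoʳ-≤ (suc r) (r*suc-r^k≤ r k (≤-trans (*-monoʳ-≤ 2 (n≤1+n k)) 2k≤r)) ⟩
  suc r * (r ^ k * (r + 2 * k))      ≤⟨ subst (λ r → suc r * (r ^ k * (r + 2 * k)) ≤ r * r ^ k * (r + 2 * suc k))
                                              (m+[n∸m]≡n 2k≤r) (step (r ∸ 2 * suc k)) ⟩
  r * r ^ k * (r + 2 * suc k)        ∎
  where
  open ≤-Reasoning
  *-comm-middle : ∀ r s a → r * (s * a) ≡ s * (r * a)
  *-comm-middle = solve-∀
  identity : ∀ k t a → suc (2 * suc k + t) * (a * (2 * suc k + t + 2 * k)) + a * (t + 2)
                     ≡ (2 * suc k + t) * a * (2 * suc k + t + 2 * suc k)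
  identity = solve-∀
  step : ∀ t → let r = 2 * suc k + t in suc r * (r ^ k * (r + 2 * k)) ≤ r * r ^ k * (r + 2 * suc k)
  step t = subst (suc r′ * (r′ ^ k * (r′ + 2 * k)) ≤_) (identity k t (r′ ^ k)) (m≤m+n _ _)
    where
    r′ : ℕ
    r′ = 2 * suc k + t

-- With S = R + δ and R = 2δ + t: 2 S² R − S³ − R³ = δ (δ² + 3 δ t + t²) > 0.
cubic-gap : ∀ S R → R < S → 2 * S ≤ 3 * R → S * S * S + R * R * R < 2 * (S * S * R)
cubic-gap S R R<S 2S≤3R with m+[n∸m]≡n (<⇒≤ R<S)
... | R+δ≡S with S ∸ R | R<S
...   | zero  | R<S′ = ⊥-elim (<-irrefl (trans (sym (+-identityʳ R)) R+δ≡S) R<S′)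
...   | suc δ | _    = subst (λ S → S * S * S + R * R * R < 2 * (S * S * R)) R+δ≡S
                             (subst (λ R → (R + suc δ) * (R + suc δ) * (R + suc δ) + R * R * R
                                            < 2 * ((R + suc δ) * (R + suc δ) * R)) (m+[n∸m]≡n 2δ≤R) (gap (R ∸ 2 * suc δ)))
  where
  2δ≤R : 2 * suc δ ≤ R
  2δ≤R = +-cancelˡ-≤ (2 * R) _ _ (subst₂ _≤_ (distrib R (suc δ)) (triple R)
                                         (subst (λ S → 2 * S ≤ 3 * R) (sym R+δ≡S) 2S≤3R))
    where
    distrib : ∀ r d → 2 * (r + d) ≡ 2 * r + 2 * d
    distrib = solve-∀
    triple : ∀ r → 3 * r ≡ 2 * r + r
    triple = solve-∀
  identity : ∀ d t → let R = 2 * suc d + t in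
    2 * ((R + suc d) * (R + suc d) * R)
      ≡ (R + suc d) * (R + suc d) * (R + suc d) + R * R * R + suc d * (suc d * suc d + 3 * suc d * t + t * t)
  identity = solve-∀
  gap : ∀ t → let R = 2 * suc δ + t in
        (R + suc δ) * (R + suc δ) * (R + suc δ) + R * R * R < 2 * ((R + suc δ) * (R + suc δ) * R)
  gap t = subst (cubes <_) (sym (identity δ t)) (m<m+n cubes (s≤s z≤n))
    where
    R′ cubes : ℕ
    R′ = 2 * suc δ + t
    cubes = (R′ + suc δ) * (R′ + suc δ) * (R′ + suc δ) + R′ * R′ * R′

rescale : ∀ r s A c D M .{{_ : NonZero s}} → r ≤ s → 3 * D ≤ M →
          c * (r ^ 3) ^ D * (s ^ 3) ^ M ≤ (s ^ 3) ^ D * A → c * (s ^ M * s ^ M * r ^ M) ≤ A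
rescale r s A c D M r≤s 3D≤M hyp = *-cancelʳ-≤ _ A (s ^ M) {{m^n≢0 s M}} (begin
  c * (s ^ M * s ^ M * r ^ M) * s ^ M           ≡⟨ gather c (s ^ M) (r ^ M) ⟩
  c * (s ^ M) ^ 3 * r ^ M                       ≡⟨ cong₂ (λ a b → c * a * b) cube-swap split-r ⟩
  c * (s ^ 3) ^ M * ((r ^ 3) ^ D * r ^ m)       ≡⟨ regroup c ((s ^ 3) ^ M) ((r ^ 3) ^ D) (r ^ m) ⟩
  c * (r ^ 3) ^ D * (s ^ 3) ^ M * r ^ m         ≤⟨ *-monoˡ-≤ (r ^ m) hyp ⟩
  (s ^ 3) ^ D * A * r ^ m                       ≤⟨ *-monoʳ-≤ ((s ^ 3) ^ D * A) (^-monoˡ-≤ m r≤s) ⟩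
  (s ^ 3) ^ D * A * s ^ m                       ≡⟨ regroup′ ((s ^ 3) ^ D) A (s ^ m) ⟩
  A * ((s ^ 3) ^ D * s ^ m)                     ≡⟨ cong (A *_) (merge s) ⟩
  A * s ^ M                                     ∎)
  where
  open ≤-Reasoning
  m : ℕ
  m = M ∸ 3 * D
  M≡ : 3 * D + m ≡ M
  M≡ = m+[n∸m]≡n 3D≤M
  merge : ∀ x → (x ^ 3) ^ D * x ^ m ≡ x ^ M
  merge x = trans (cong (_* x ^ m) (^-*-assoc x 3 D)) (trans (sym (^-distribˡ-+-* x (3 * D) m)) (cong (x ^_) M≡))
  split-r : r ^ M ≡ (r ^ 3) ^ D * r ^ m
  split-r = sym (merge r)
  cube-swap : (s ^ M) ^ 3 ≡ (s ^ 3) ^ M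
  cube-swap = trans (^-*-assoc s M 3) (trans (cong (s ^_) (*-comm M 3)) (sym (^-*-assoc s 3 M)))
  gather : ∀ c a b → c * (a * a * b) * a ≡ c * (a * (a * (a * 1))) * b
  gather = solve-∀
  regroup : ∀ c a b e → c * a * (b * e) ≡ c * b * a * e
  regroup = solve-∀
  regroup′ : ∀ a b e → a * b * e ≡ b * (a * e)
  regroup′ = solve-∀

-- γ = Q / b where, with x = (r/s)³, Q = X^q Σ_{y ≤ q} x^y and b = X^q (r/s)^q; taking
-- r = 4q makes (r/s)^q ≥ 2/3 and the pairing bound then gives Q < (q + 1) b.
module Constants (q′ : ℕ) where

  q r s S R X Y : ℕ
  q = suc q′
  r = 4 * q
  s = suc r
  S = s ^ q
  R = r ^ q
  X = s ^ 3
  Y = r ^ 3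

  cube : ∀ a → a ^ 3 ≡ a * a * a
  cube a = trans (cong (λ t → a * (a * t)) (*-identityʳ a)) (sym (*-assoc a a a))

  Y≤X : Y ≤ X
  Y≤X = ^-monoˡ-≤ 3 (n≤1+n r)

  open ExponentVectors.Rankin q X Y Y≤X public using (Q)
  open GeometricSum X Y using (geom; sumFin≡geom; X^m≤geom; 2*geom≤)

  b : ℕ
  b = S * S * R

  X^q≡S³ : X ^ q ≡ S * S * S
  X^q≡S³ = trans (^-*-assoc s 3 q) (trans (cong (s ^_) (*-comm 3 q)) (trans (sym (^-*-assoc s q 3)) (cube S)))

  Y^q≡R³ : Y ^ q ≡ R * R * R
  Y^q≡R³ = trans (^-*-assoc r 3 q) (trans (cong (r ^_) (*-comm 3 q)) (trans (sym (^-*-assoc r q 3)) (cube R)))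

  Q≡geom : Q ≡ geom q
  Q≡geom = trans (∑-allFin (suc q) (λ y → Y ^ toℕ y * X ^ (q ∸ toℕ y))) (sumFin≡geom q)

  R<S : R < S
  R<S = ^-monoˡ-< q (n<1+n r)

  2S≤3R : 2 * S ≤ 3 * R
  2S≤3R = *-cancelˡ-≤ (2 * q) (subst₂ _≤_ (regroupˡ q S) (regroupʳ q R) (r*suc-r^k≤ r q (*-monoˡ-≤ q {2} {4} (s≤s (s≤s z≤n)))))
    where
    regroupˡ : ∀ q S → 4 * q * S ≡ 2 * q * (2 * S)
    regroupˡ = solve-∀
    regroupʳ : ∀ q R → R * (4 * q + 2 * q) ≡ 2 * q * (3 * R)
    regroupʳ = solve-∀

  1≤b : 1 ≤ b
  1≤b = *-mono-≤ (*-mono-≤ (m^n>0 s q) (m^n>0 s q)) (m^n>0 r q)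

  b≤Q : b ≤ Q
  b≤Q = begin
    S * S * R   ≤⟨ *-monoʳ-≤ (S * S) (<⇒≤ R<S) ⟩
    S * S * S   ≡⟨ sym X^q≡S³ ⟩
    X ^ q       ≤⟨ X^m≤geom q ⟩
    geom q      ≡⟨ sym Q≡geom ⟩
    Q           ∎
    where open ≤-Reasoning

  Q<p*b : Q < suc q * b
  Q<p*b = *-cancelˡ-< 2 Q (suc q * b) (begin-strict
    2 * Q                               ≡⟨ cong (2 *_) Q≡geom ⟩
    2 * geom q                          ≤⟨ 2*geom≤ (X ∸ Y) (sym (m+[n∸m]≡n Y≤X)) q ⟩
    suc q * (X ^ q + Y ^ q)             ≡⟨ cong₂ (λ a c → suc q * (a + c)) X^q≡S³ Y^q≡R³ ⟩
    suc q * (S * S * S + R * R * R)     <⟨ *-monoʳ-< (suc q) (cubic-gap S R R<S 2S≤3R) ⟩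
    suc q * (2 * b)                     ≡⟨ *-comm-middle (suc q) 2 b ⟩
    2 * (suc q * b)                     ∎)
    where
    open ≤-Reasoning
    *-comm-middle : ∀ a c e → a * (c * e) ≡ c * (a * e)
    *-comm-middle = solve-∀

  b^n≤ : ∀ n D c → 3 * D ≤ q * n → c * Y ^ D * X ^ (q * n) ≤ X ^ D * Q ^ n → c * b ^ n ≤ Q ^ n
  b^n≤ n D c 3D≤qn hyp = subst (λ e → c * e ≤ Q ^ n) (sym b^n≡) (rescale r s (Q ^ n) c D (q * n) (n≤1+n r) 3D≤qn hyp)
    where
    b^n≡ : b ^ n ≡ s ^ (q * n) * s ^ (q * n) * r ^ (q * n)
    b^n≡ = trans (^-distribʳ-* (S * S) R n)
                 (cong₂ _*_ (trans (^-distribʳ-* S S n) (cong₂ _*_ (^-*-assoc s q n) (^-*-assoc s q n)))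
                            (^-*-assoc r q n))

module _ {d : ℕ} {_≺_ : Rel (Fin d) 0ℓ} (≺-trans : Transitive _≺_) (≺-irrefl : Irreflexive _≡_ _≺_)
         {B : Fin d → Set} (up-or-B : ∀ ℓ → (∃ λ m → ℓ ≺ m) ⊎ B ℓ)
         {C : Set} {_≼_ : Rel C 0ℓ} (≼-trans : Transitive _≼_)
         (φ : Fin d → C) (φ-mono : ∀ {ℓ m} → ℓ ≺ m → φ ℓ ≼ φ m) (A : C) (φ-B : ∀ ℓ → B ℓ → φ ℓ ≼ A) where

  ascend : ∀ k ℓ → φ ℓ ≼ A ⊎ ∃ λ (c : Fin (suc k) → Fin d) → c zero ≡ ℓ × (∀ {i j} → toℕ i < toℕ j → c i ≺ c j)
  ascend zero    ℓ = inj₂ ((λ _ → ℓ) , refl , λ { {zero} {zero} () })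
  ascend (suc k) ℓ with up-or-B ℓ
  ... | inj₂ Bℓ = inj₁ (φ-B ℓ Bℓ)
  ... | inj₁ (m , ℓ≺m) with ascend k m
  ...   | inj₁ φm≼A = inj₁ (≼-trans (φ-mono ℓ≺m) φm≼A)
  ...   | inj₂ (c , c₀≡m , c-inc) = inj₂ (ℓ Vector.∷ c , refl , inc)
    where
    ℓ≺c₀ : ℓ ≺ c zero
    ℓ≺c₀ = subst (ℓ ≺_) (sym c₀≡m) ℓ≺m
    inc : ∀ {i j} → toℕ i < toℕ j → (ℓ Vector.∷ c) i ≺ (ℓ Vector.∷ c) j
    inc {zero}  {suc zero}    _   = ℓ≺c₀
    inc {zero}  {suc (suc j)} _   = ≺-trans ℓ≺c₀ (c-inc {zero} {suc j} (s≤s z≤n))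
    inc {suc i} {suc j}       i<j = c-inc (s≤s⁻¹ i<j)

  -- The ascent from ℓ must reach B within d steps, since a ≺-chain cannot repeat.
  climb : ∀ ℓ → φ ℓ ≼ A
  climb ℓ with ascend d ℓ
  ... | inj₁ φℓ≼A = φℓ≼A
  ... | inj₂ (c , _ , c-inc) with Fin.pigeonhole (n<1+n d) c
  ...   | i , j , i<j , cᵢ≡cⱼ = ⊥-elim (≺-irrefl cᵢ≡cⱼ (c-inc i<j))

∃-≢ : {d : ℕ} → 2 ≤ d → (ℓ : Fin d) → ∃ λ m → ¬ ℓ ≡ m
∃-≢ (s≤s (s≤s _)) zero    = suc zero , λ ()
∃-≢ (s≤s (s≤s _)) (suc _) = zero , λ ()

neighbour : {d : ℕ} {_≺_ : Rel (Fin d) 0ℓ} → HasseConnected _≺_ → 2 ≤ d →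
            ∀ ℓ → (∃ λ m → ℓ ≺ m) ⊎ (∃ λ m → m ≺ ℓ)
neighbour {_≺_ = _≺_} connected 2≤d ℓ with ∃-≢ 2≤d ℓ
... | m , ℓ≢m = first-step ℓ≢m (connected ℓ m)
  where
  first-step : ∀ {m} → ¬ ℓ ≡ m → Star (λ a b → Cover _≺_ a b ⊎ Cover _≺_ b a) ℓ m → (∃ λ m → ℓ ≺ m) ⊎ (∃ λ m → m ≺ ℓ)
  first-step ℓ≢ℓ ε                    = ⊥-elim (ℓ≢ℓ refl)
  first-step _   (inj₁ (ℓ≺m , _) ◅ _) = inj₁ (_ , ℓ≺m)
  first-step _   (inj₂ (m≺ℓ , _) ◅ _) = inj₂ (_ , m≺ℓ)

∣∑⇒∣isolated : {A : Set} {p : ℕ} (xs : List A) (f Δ : A → ℕ) (V : ℕ) → ∑ xs Δ ≡ 1 →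
               (∀ x → (Δ x ≡ 1 × f x ≡ V) ⊎ (Δ x ≡ 0 × p ∣ f x)) → p ∣ ∑ xs f → p ∣ V
∣∑⇒∣isolated {p = p} xs f Δ V ∑Δ≡1 cases p∣∑f with split xs
  where
  split : ∀ xs → ∃ λ R → ∑ xs f ≡ ∑ xs Δ * V + R × p ∣ R
  split []       = 0 , refl , p ∣0
  split (x ∷ xs) with split xs | cases x
  ... | R , ∑≡ , p∣R | inj₁ (Δ≡1 , f≡V) = R , (begin
    f x + ∑ xs f                  ≡⟨ cong₂ _+_ (trans f≡V (sym (*-identityˡ V))) ∑≡ ⟩
    1 * V + (∑ xs Δ * V + R)      ≡⟨ sym (+-assoc (1 * V) _ R) ⟩
    1 * V + ∑ xs Δ * V + R        ≡⟨ cong (λ δ → δ * V + ∑ xs Δ * V + R) (sym Δ≡1) ⟩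
    Δ x * V + ∑ xs Δ * V + R      ≡⟨ cong (_+ R) (sym (*-distribʳ-+ V (Δ x) _)) ⟩
    (Δ x + ∑ xs Δ) * V + R        ∎) , p∣R
    where open ≡-Reasoning
  ... | R , ∑≡ , p∣R | inj₂ (Δ≡0 , p∣f) = f x + R , (begin
    f x + ∑ xs f                  ≡⟨ cong (f x +_) ∑≡ ⟩
    f x + (∑ xs Δ * V + R)        ≡⟨ +-comm-middle (f x) (∑ xs Δ * V) R ⟩
    ∑ xs Δ * V + (f x + R)        ≡⟨ cong (λ δ → (δ + ∑ xs Δ) * V + (f x + R)) (sym Δ≡0) ⟩
    (Δ x + ∑ xs Δ) * V + (f x + R) ∎) , ∣m∣n⇒∣m+n p∣f p∣R
    where
    open ≡-Reasoning
    +-comm-middle : ∀ a b c → a + (b + c) ≡ b + (a + c)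
    +-comm-middle = solve-∀
... | R , ∑≡ , p∣R = ∣m+n∣m⇒∣n (subst (p ∣_) ∑≡R+V p∣∑f) p∣R
  where
  ∑≡R+V : ∑ xs f ≡ R + V
  ∑≡R+V = trans ∑≡ (trans (cong (λ s → s * V + R) ∑Δ≡1) (trans (cong (_+ R) (*-identityˡ V)) (+-comm V R)))

module _ {N : ℕ} where
  open import Data.List.Membership.DecPropositional (_≟_ {N}) using (_∈?_)

  ¬∃∉⇒∈ : {xs : List (Fin N)} → ¬ (∃ λ a → ¬ a ∈ xs) → ∀ a → a ∈ xs
  ¬∃∉⇒∈ {xs} none a = decidable-stable (a ∈? xs) (λ a∉ → none (a , a∉))

  length<⇒∃∉ : (xs : List (Fin N)) → length xs < N → ∃ λ a → ¬ a ∈ xs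
  length<⇒∃∉ xs |xs|<N with Fin.any? (λ a → ¬? (a ∈? xs))
  ... | yes found = found
  ... | no none with Fin.pigeonhole |xs|<N (λ a → index (¬∃∉⇒∈ none a))
  ...   | i , j , i<j , same = ⊥-elim (<-irrefl (cong toℕ i≡j) i<j)
    where
    i≡j : i ≡ j
    i≡j = trans (lookup-index (¬∃∉⇒∈ none i)) (trans (cong (lookup xs) same) (sym (lookup-index (¬∃∉⇒∈ none j))))

module SumOrderedSize (q : ℕ) (pp : Prime (suc q)) {d n N : ℕ} (3≤d : 3 ≤ d)
                      (x : Fin d → Fin N → Fpn (suc q) n) (sum-ordered : SumOrdered (suc q) n d N x) where

  open SumZeroPolynomial q d n using (P; P-cong; P-divisible; P-coprime; coordinateSum; weightedSum-divisible)
  open ExponentVectors q using (ofDegree≤; ofDegree≤-complete)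

  _≺_ : Rel (Fin d) 0ℓ
  _≺_ = proj₁ (proj₂ sum-ordered)

  open IsStrictPartialOrder (proj₁ (proj₂ (proj₂ sum-ordered))) using () renaming (trans to ≺-trans; irrefl to ≺-irrefl)

  tuples-sum-zero : ∀ i → SumZero (suc q) n d (λ ℓ → x ℓ i)
  tuples-sum-zero = proj₁ sum-ordered

  in-polytope : ∀ ι → SumZero (suc q) n d (λ ℓ → x ℓ (ι ℓ)) → InOrderPolytope _≺_ ι
  in-polytope = proj₂ (proj₂ (proj₂ (proj₂ sum-ordered)))

  coords : Fin d → Fin N → Fin n → ℕ
  coords ℓ i k = toℕ (x ℓ i k)

  exponents : List (Fin n → Fin (suc q))
  exponents = ofDegree≤ n (q * n / 3)

  Direction : Fin d → Set
  Direction ℓ = (∃ λ m → ℓ ≺ m) ⊎ (∃ λ m → m ≺ ℓ)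

  direction : ∀ ℓ → Direction ℓ
  direction = neighbour (proj₁ (proj₂ (proj₂ (proj₂ sum-ordered)))) (≤-trans (n≤1+n 2) 3≤d)

  rankAlong : ∀ {ℓ} → Direction ℓ → Fin N → ℕ
  rankAlong (inj₁ _) b = toℕ b
  rankAlong (inj₂ _) b = N ∸ toℕ b

  rankAlong-injective : ∀ {ℓ} (w : Direction ℓ) → Injective _≡_ _≡_ (rankAlong w)
  rankAlong-injective (inj₁ _)         eq = Fin.toℕ-injective eq
  rankAlong-injective (inj₂ _) {a} {b} eq = Fin.toℕ-injective (∸-cancelˡ-≡ (<⇒≤ (Fin.toℕ<n a)) (<⇒≤ (Fin.toℕ<n b)) eq)

  up-or-capped : ∀ {ℓ} (w : Direction ℓ) (a b : Fin N) →
                 (∃ λ m → ℓ ≺ m) ⊎ (¬ rankAlong w b < rankAlong w a → toℕ b ≤ toℕ a)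
  up-or-capped (inj₁ up) a b = inj₁ up
  up-or-capped (inj₂ _)  a b = inj₂ (λ ¬< → ≮⇒≥ (λ a<b → ¬< (∸-monoʳ-< a<b (<⇒≤ (Fin.toℕ<n b)))))

  down-or-floored : ∀ {ℓ} (w : Direction ℓ) (a b : Fin N) →
                    (∃ λ m → m ≺ ℓ) ⊎ (¬ rankAlong w b < rankAlong w a → toℕ a ≤ toℕ b)
  down-or-floored (inj₁ _)    a b = inj₂ ≮⇒≥
  down-or-floored (inj₂ down) a b = inj₁ down

  rank : Fin d → Fin N → ℕ
  rank ℓ = rankAlong (direction ℓ)

  polytope-rank-diagonal : (a : Fin N) (ι : Fin d → Fin N) → InOrderPolytope _≺_ ι →
                           (∀ ℓ → ¬ rank ℓ (ι ℓ) < rank ℓ a) → ∀ ℓ → ι ℓ ≡ a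
  polytope-rank-diagonal a ι ι∈ ¬< ℓ = Fin.toℕ-injective (≤-antisym ι≤a a≤ι)
    where
    ι≤a : toℕ (ι ℓ) ≤ toℕ a
    ι≤a = climb {_≺_ = _≺_} ≺-trans ≺-irrefl (λ m → up-or-capped (direction m) a (ι m)) {_≼_ = _≤_} ≤-trans
                (λ m → toℕ (ι m)) (λ {u} {v} → ι∈ u v) (toℕ a) (λ m capped → capped (¬< m)) ℓ
    a≤ι : toℕ a ≤ toℕ (ι ℓ)
    a≤ι = climb {_≺_ = λ u v → v ≺ u} (λ u≻v v≻w → ≺-trans v≻w u≻v) (λ eq → ≺-irrefl (sym eq))
                (λ m → down-or-floored (direction m) a (ι m)) {_≼_ = λ u v → v ≤ u} (λ u≥v v≥w → ≤-trans v≥w u≥v)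
                (λ m → toℕ (ι m)) (λ {u} {v} → ι∈ v u) (toℕ a) (λ m floored → floored (¬< m)) ℓ

  lowMonomials : Fin d → List (Fin N → ℕ)
  lowMonomials ℓ = map (λ e i → monomial n (λ k → toℕ (e k)) (coords ℓ i)) exponents

  module Elimination (ℓ : Fin d) = TriangularAnnihilators q N pp (rank ℓ) (rankAlong-injective (direction ℓ))
  open Elimination using (Annihilator; annihilators)
  open Annihilator

  module CommonNonpivot (a : Fin N) (c : Fin d → Fin N → ℕ) (ann : ∀ ℓ → Annihilator ℓ (lowMonomials ℓ) a (c ℓ)) where

    ιs : List (Fin d → Fin N)
    ιs = choices d (allFin N)
    term : (Fin d → Fin N) → ℕ
    term ι = ∏ d (λ ℓ → c ℓ (ι ℓ)) * P (λ ℓ → coords ℓ (ι ℓ))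
    V : ℕ
    V = ∏ d (λ ℓ → c ℓ a) * P (λ ℓ → coords ℓ a)
    Δ : (Fin d → Fin N) → ℕ
    Δ ι = ∏ d (λ ℓ → 𝟙 (a ≟ ι ℓ))

    ∑Δ≡1 : ∑ ιs Δ ≡ 1
    ∑Δ≡1 = trans (sym (∏-∑-distrib d (allFin N) (λ _ i → 𝟙 (a ≟ i))))
                 (trans (∏-cong d (λ _ → trans (∑-allFin N _) (sumFin-𝟙≟ N a))) (∏-one d))

    V-coprime : ¬ suc q ∣ V
    V-coprime p∣V with euclidsLemma _ _ pp p∣V
    ... | inj₂ p∣P = P-coprime pp (λ ℓ → coords ℓ a) (tuples-sum-zero a) p∣P
    ... | inj₁ p∣∏ with prime∣∏⇒∣factor pp d _ p∣∏
    ...   | ℓ , p∣cℓa = pivot (ann ℓ) p∣cℓa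

    annihilates : ∀ ℓ (e : Fin n → ℕ) → (∀ k → e k ≤ q) → 3 * sumFin n e ≤ q * n →
                  suc q ∣ ∑ (allFin N) (λ i → c ℓ i * monomial n e (coords ℓ i))
    annihilates ℓ e e≤q 3Σe≤qn with ofDegree≤-complete n (q * n / 3) e e≤q Σe≤D
      where
      Σe≤D : sumFin n e ≤ q * n / 3
      Σe≤D = subst (_≤ q * n / 3) (m*n/n≡m (sumFin n e) 3) (/-monoˡ-≤ 3 (subst (_≤ q * n) (*-comm 3 (sumFin n e)) 3Σe≤qn))
    ... | e′ , e′∈ , e′≗e = subst (suc q ∣_) (∑-cong (allFin N) (λ i → cong (c ℓ i *_) (monomial-≗ i)))
                                  (kills (ann ℓ) _ (∈-map⁺ _ e′∈))
      where
      monomial-≗ : ∀ i → monomial n (λ k → toℕ (e′ k)) (coords ℓ i) ≡ monomial n e (coords ℓ i)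
      monomial-≗ i = ∏-cong n (λ k → cong (coords ℓ i k ^_) (e′≗e k))

    off-diagonal : (ι : Fin d → Fin N) (ℓ₀ : Fin d) → ¬ ι ℓ₀ ≡ a → suc q ∣ term ι
    off-diagonal ι ℓ₀ ι≢a with Fin.any? (λ ℓ → rank ℓ (ι ℓ) <? rank ℓ a)
    ... | yes (ℓ , below) = subst (suc q ∣_) (sym (cong (_* P (λ ℓ → coords ℓ (ι ℓ))) (∏-zero d (λ ℓ → c ℓ (ι ℓ)) ℓ (upper (ann ℓ) (ι ℓ) below)))) (suc q ∣0)
    ... | no none with Fin.any? (λ k → ¬? (suc q ∣? coordinateSum (λ ℓ → coords ℓ (ι ℓ)) k))
    ...   | yes (k , p∤) = ∣-trans (P-divisible (λ ℓ → coords ℓ (ι ℓ)) k p∤) (n∣m*n (∏ d (λ ℓ → c ℓ (ι ℓ))))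
    ...   | no none′ = ⊥-elim (ι≢a (polytope-rank-diagonal a ι (in-polytope ι sum-zero) (λ ℓ below → none (ℓ , below)) ℓ₀))
      where
      sum-zero : SumZero (suc q) n d (λ ℓ → x ℓ (ι ℓ))
      sum-zero k = decidable-stable (suc q ∣? _) (λ p∤ → none′ (k , p∤))

    classify : ∀ ι → (Δ ι ≡ 1 × term ι ≡ V) ⊎ (Δ ι ≡ 0 × suc q ∣ term ι)
    classify ι with Fin.any? (λ ℓ → ¬? (ι ℓ ≟ a))
    ... | yes (ℓ₀ , ι≢a) = inj₂ (∏-zero d _ ℓ₀ (𝟙-no (a ≟ ι ℓ₀) (λ a≡ → ι≢a (sym a≡))) , off-diagonal ι ℓ₀ ι≢a)
    ... | no none = inj₁ (trans (∏-cong d (λ ℓ → 𝟙-yes (a ≟ ι ℓ) (sym (ι≡a ℓ)))) (∏-one d)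
                         , cong₂ _*_ (∏-cong d (λ ℓ → cong (c ℓ) (ι≡a ℓ))) (P-cong (λ ℓ k → cong (λ i → coords ℓ i k) (ι≡a ℓ))))
      where
      ι≡a : ∀ ℓ → ι ℓ ≡ a
      ι≡a ℓ = decidable-stable (ι ℓ ≟ a) (λ ι≢a → none (ℓ , ι≢a))

    absurd : ⊥
    absurd = V-coprime (∣∑⇒∣isolated ιs term Δ V ∑Δ≡1 classify (weightedSum-divisible N coords c 3≤d annihilates))

  pivots : Fin d → List (Fin N)
  pivots ℓ = proj₁ (annihilators ℓ (lowMonomials ℓ))

  annihilator : Fin d → Fin N → Fin N → ℕ
  annihilator ℓ = proj₁ (proj₂ (proj₂ (annihilators ℓ (lowMonomials ℓ))))

  annihilator-spec : ∀ ℓ a → ¬ a ∈ pivots ℓ → Annihilator ℓ (lowMonomials ℓ) a (annihilator ℓ a)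
  annihilator-spec ℓ = proj₂ (proj₂ (proj₂ (annihilators ℓ (lowMonomials ℓ))))

  allPivots : List (Fin N)
  allPivots = concatMap pivots (allFin d)

  length-allPivots : length allPivots ≤ d * length exponents
  length-allPivots = begin
    length allPivots                          ≡⟨ length-concatMap pivots (allFin d) ⟩
    ∑ (allFin d) (λ ℓ → length (pivots ℓ))    ≤⟨ ∑-mono-≤ (allFin d) (λ ℓ → ≤-trans (proj₁ (proj₂ (annihilators ℓ (lowMonomials ℓ))))
                                                                                (≤-reflexive (length-map _ exponents))) ⟩
    ∑ (allFin d) (λ _ → length exponents)     ≡⟨ trans (∑-allFin d _) (sumFin-const d _) ⟩
    d * length exponents                      ∎
    where open ≤-Reasoning

  size≤ : N ≤ d * length exponents
  size≤ with N ≤? d * length exponents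
  ... | yes N≤ = N≤
  ... | no N≰ with length<⇒∃∉ allPivots (≤-<-trans length-allPivots (≰⇒> N≰))
  ...   | a , a∉ = ⊥-elim (CommonNonpivot.absurd a (λ ℓ → annihilator ℓ a)
                     (λ ℓ → annihilator-spec ℓ a (λ a∈ → a∉ (∈-concatMap⁺ pivots (lose (∈-allFin ℓ) a∈)))))

theorem6p1 : ∀ (p d : ℕ) → Prime p → 2 < d →
    ∃ λ (C : ℕ) → ∃ λ (a : ℕ) → ∃ λ (b : ℕ) →
      1 ≤ C × 1 ≤ b × b ≤ a × a < p * b ×
      (∀ (n : ℕ) → 1 ≤ n → ∀ (N : ℕ) (x : Fin d → Fin N → Fpn p n) →
        SumOrdered p n d N x → N * b ^ n ≤ C * a ^ n)
theorem6p1 zero             d pp _   = ⊥-elim (¬prime[0] pp)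
theorem6p1 (suc zero)       d pp _   = ⊥-elim (¬prime[1] pp)
theorem6p1 (suc (suc q′))   d pp 2<d = d , Q , b , ≤-trans (s≤s z≤n) 2<d , 1≤b , b≤Q , Q<p*b , size-bound
  where
  open Constants q′
  open ExponentVectors.Rankin q X Y Y≤X using (length-ofDegree≤)
  size-bound : ∀ n → 1 ≤ n → ∀ N (x : Fin d → Fin N → Fpn (suc q) n) → SumOrdered (suc q) n d N x → N * b ^ n ≤ d * Q ^ n
  size-bound n _ N x sum-ordered = begin
    N * b ^ n                            ≤⟨ *-monoˡ-≤ (b ^ n) (SumOrderedSize.size≤ q pp 2<d x sum-ordered) ⟩
    d * length exponents * b ^ n         ≡⟨ *-assoc d _ (b ^ n) ⟩
    d * (length exponents * b ^ n)       ≤⟨ *-monoʳ-≤ d (b^n≤ n D (length exponents) 3D≤qn (length-ofDegree≤ n D)) ⟩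
    d * Q ^ n                            ∎
    where
    open ≤-Reasoning
    D : ℕ
    D = q * n / 3
    exponents : List (Fin n → Fin (suc q))
    exponents = ExponentVectors.ofDegree≤ q n D
    3D≤qn : 3 * D ≤ q * n
    3D≤qn = subst (_≤ q * n) (*-comm D 3) (m/n*n≤m (q * n) 3)
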